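{- Let $m,n$ be positive integers and, for $k\ge0$, let $H^{(m)}_{n,k}$ be the $n\times n$ matrix with rows and columns indexed by $0,\dots,n-1$ whose $(i,j)$ entry is $\binom{\lfloor i/m\rfloor}{k}$ if $i-j=mk$ and $0$ otherwise. Put $H^{(m)}_n=H^{(m)}_{n,1}$ and $P^{(m)}_n=\sum_{k\ge0}H^{(m)}_{n,k}$. Then $H^{(m)}_{n,k}=\frac{(H^{(m)}_n)^k}{k!}$ for all $k\ge0$, and $$P^{(m)}_n=\exp\bigl(H^{(m)}_n\bigr)=\prod_{k\ge1}\bigl(I_n+c_kH^{(m)}_{n,k}\bigr),$$ where the $c_k$ are the numbers with $\exp(x)=\prod_{k\ge1}\bigl(1+\frac{c_k}{k!}x^k\bigr)$ as formal power series.
   Context: $I_n$ is the $n\times n$ identity matrix. The matrices $H^{(m)}_{n,k}$ vanish for $mk\ge n$, so all sums and products are finite; they are polynomials in $H^{(m)}_n$ and hence commute. For $m=1$, $P^{(1)}_n=\bigl(\binom ij\bigr)_{i,j=0}^{n-1}$ is the Pascal matrix. -}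

module Defs where

open import Data.Nat as ℕ using (ℕ; zero; suc; NonZero; _!; _≟_)
open import Data.Nat.Properties using (_!≢0)
open import Data.Nat.Combinatorics using (_C_)
open import Data.Integer using (+_)
open import Data.Fin using (Fin; toℕ)
open import Data.Rational using (ℚ; 0ℚ; 1ℚ; _+_; _*_; _/_)
open import Relation.Nullary using (yes; no)
open import Relation.Binary.PropositionalEquality using (_≡_)

ℕ→ℚ : ℕ → ℚ
ℕ→ℚ a = (+ a) / 1

inv! : ℕ → ℚ
inv! k = ((+ 1) / (k !)) {{k !≢0}}

Mat : ℕ → Set
Mat n = Fin n → Fin n → ℚ

_≡M_ : ∀ {n} → Mat n → Mat n → Set
A ≡M B = ∀ i j → A i j ≡ B i j

sumℚ : ℕ → (ℕ → ℚ) → ℚ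
sumℚ zero    f = 0ℚ
sumℚ (suc K) f = sumℚ K f + f K

sumFin : ∀ n → (Fin n → ℚ) → ℚ
sumFin zero    f = 0ℚ
sumFin (suc n) f = f Data.Fin.zero + sumFin n (λ i → f (Data.Fin.suc i))

𝟘 : ∀ {n} → Mat n
𝟘 i j = 0ℚ

I : ∀ n → Mat n
I n i j with toℕ i ≟ toℕ j
... | yes _ = 1ℚ
... | no  _ = 0ℚ

_⊕_ : ∀ {n} → Mat n → Mat n → Mat n
(A ⊕ B) i j = A i j + B i j

_⊗_ : ∀ {n} → Mat n → Mat n → Mat n
_⊗_ {n} A B i j = sumFin n (λ l → A i l * B l j)

_·_ : ∀ {n} → ℚ → Mat n → Mat n
(q · A) i j = q * A i j

_^M_ : ∀ {n} → Mat n → ℕ → Mat n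
_^M_ {n} A zero    = I n
_^M_ {n} A (suc k) = (A ^M k) ⊗ A

sumM : ∀ {n} → ℕ → (ℕ → Mat n) → Mat n
sumM zero    F = 𝟘
sumM (suc K) F = sumM K F ⊕ F K

-- ∏_{k=1}^{K} F k   (the factors commute here, order is irrelevant)
prodM₁ : ∀ {n} → ℕ → (ℕ → Mat n) → Mat n
prodM₁ {n} zero    F = I n
prodM₁ {n} (suc K) F = prodM₁ K F ⊗ F (suc K)

Hk : (m : ℕ) .{{_ : NonZero m}} (n k : ℕ) → Mat n
Hk m n k i j with toℕ i ≟ toℕ j ℕ.+ m ℕ.* k
... | yes _ = ℕ→ℚ ((toℕ i ℕ./ m) C k)
... | no  _ = 0ℚ

H : (m : ℕ) .{{_ : NonZero m}} (n : ℕ) → Mat n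
H m n = Hk m n 1

-- P^{(m)}_n = Σ_{k≥0} H^{(m)}_{n,k}; the terms with k ≥ n vanish
-- (since m ≥ 1 and i < n), so the sum is over k < n.
P : (m : ℕ) .{{_ : NonZero m}} (n : ℕ) → Mat n
P m n = sumM n (Hk m n)

expM : ∀ {n} → ℕ → Mat n → Mat n
expM K A = sumM K (λ k → inv! k · (A ^M k))

Series : Set
Series = ℕ → ℚ

_⋆_ : Series → Series → Series
(f ⋆ g) N = sumℚ (suc N) (λ i → f i * g (N ℕ.∸ i))

oneS : Series
oneS zero    = 1ℚ
oneS (suc _) = 0ℚ

-- the series 1 + a x^k  (for k ≥ 1)
onePlusMono : ℚ → ℕ → Series
onePlusMono a k N with N ≟ k
... | yes _ = a
... | no  _ = oneS N

prodS : (ℕ → ℚ) → ℕ → Series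
prodS c zero    = oneS
prodS c (suc K) = prodS c K ⋆ onePlusMono (c (suc K) * inv! (suc K)) (suc K)

-- c satisfies exp(x) = ∏_{k≥1} (1 + c_k x^k / k!) as formal power series:
-- the coefficient of x^N of the infinite product equals that of the
-- partial product over k ≤ N (factors with k > N do not affect it),
-- and it must equal 1/N!.
IsExpProdCoeffs : (ℕ → ℚ) → Set
IsExpProdCoeffs c = ∀ N → prodS c N N ≡ inv! N

module Submission where

-- Every matrix in the theorem is m-banded: its entry (i, j) vanishes unless
-- i = j + m·N (i lies on the N-th m-diagonal below j), and there it depends only
-- on N and the block index q = ⌊i/m⌋.  We describe such a matrix by its symbol
-- φ N q (HasSymbol) and compute with symbols instead of matrices:
--  * H_{n,k} has symbol [N = k]·C(q,k), and I has symbol [N = 0];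
--  * right multiplication by a matrix living on the s-th diagonal shifts a
--    symbol by s (symbol-⊗-single): only the column l = j + m·s contributes,
--    and ⌊l/m⌋ = q - (N - s);
--  * so Hᵏ has symbol [N = k]·q^(k) (falling factorial), and ∏_{k≤K}(I + c_k H_{n,k})
--    has symbol ([X^N] ∏_{k≤K}(1 + c_k/k!·Xᵏ))·q^(N), the coefficient being
--    computed by the same shifting, now on power series;
--  * matrices whose symbols agree on the diagonals N < n are equal (symbol-unique).
-- Since q^(N)/N! = C(q,N) and the product coefficient is 1/N! for N ≤ K, all
-- matrices in the theorem have symbol C(q,N), which proves it.

open import Defs
open import Data.Nat as ℕ using (ℕ; zero; suc; NonZero; _!; _≟_; _≤?_; z≤n; s≤s; _≤_; _<_; _∸_)
import Data.Nat.Properties as ℕP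
open ℕP using (_!≢0)
open import Data.Nat.Combinatorics using (_C_; nC1≡n)
open import Data.Nat.Combinatorics.Base using (_P′_)
import Data.Integer as ℤ
import Data.Integer.Properties as ℤP
open import Data.Rational as Rational using (ℚ; 0ℚ; 1ℚ; toℚᵘ)
import Data.Rational.Properties as ℚP
import Data.Rational.Unnormalised as ℚᵘ
import Data.Rational.Unnormalised.Properties as ℚᵘP
open import Data.Rational.Solver using (module +-*-Solver)
open import Data.Fin using (Fin; toℕ; fromℕ<)
import Data.Fin as Fin
import Data.Fin.Properties as FinP
open import Algebra.Bundles using (CommutativeMonoid)
import Algebra.Properties.CommutativeSemigroup as CommSemigroupProperties
open import Relation.Binary.PropositionalEquality
open import Relation.Nullary using (¬_; yes; no)
open import Data.Empty using (⊥-elim)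
open import Data.Sum using (inj₁; inj₂)
open import Data.Product using (_×_; _,_)
open import Function using (_∘_)

module FallingFactorial where
  open import Data.Nat using (_+_; _*_)
  open import Data.Nat.Properties
  open import Data.Nat.DivMod using (_/_; m*[n/m]≡n)
  open import Data.Nat.Combinatorics as Combinatorics using (nCk≡nPk/k!; nPk≡n!/[n∸k]!; k>n⇒nCk≡0)
  open import Data.Nat.Combinatorics.Specification using (nP′k≡n!/[n∸k]!; k!∣nP′k)
  open import Algebra.Properties.CommutativeSemigroup *-commutativeSemigroup using (x∙yz≈y∙xz)
  open ≡-Reasoning

  falling-beyond : ∀ {q k} → q < k → q P′ k ≡ 0
  falling-beyond {q} {suc k} (s≤s q≤k) = cong (_* (q P′ k)) (m≤n⇒m∸n≡0 q≤k)

  falling-+ : ∀ q a b → q P′ (a + b) ≡ (q P′ a) * ((q ∸ a) P′ b)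
  falling-+ q a zero = trans (cong (q P′_) (+-identityʳ a)) (sym (*-identityʳ (q P′ a)))
  falling-+ q a (suc b) = begin
    q P′ (a + suc b)                          ≡⟨ cong (q P′_) (+-suc a b) ⟩
    (q ∸ (a + b)) * (q P′ (a + b))            ≡⟨ cong₂ _*_ (sym (∸-+-assoc q a b)) (falling-+ q a b) ⟩
    (q ∸ a ∸ b) * ((q P′ a) * ((q ∸ a) P′ b)) ≡⟨ x∙yz≈y∙xz (q ∸ a ∸ b) (q P′ a) _ ⟩
    (q P′ a) * ((q ∸ a ∸ b) * ((q ∸ a) P′ b)) ∎

  falling≡!*C : ∀ q k → q P′ k ≡ k ! * (q C k)
  falling≡!*C q k with k ≤? q
  ... | no k≰q = begin
    q P′ k         ≡⟨ falling-beyond (≰⇒> k≰q) ⟩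
    0              ≡⟨ sym (*-zeroʳ (k !)) ⟩
    k ! * 0        ≡⟨ cong (k ! *_) (sym (k>n⇒nCk≡0 (≰⇒> k≰q))) ⟩
    k ! * (q C k)  ∎
  ... | yes k≤q = begin
    q P′ k                               ≡⟨ sym (m*[n/m]≡n (k!∣nP′k k≤q)) ⟩
    k ! * ((q P′ k) / k !)               ≡⟨ cong (λ x → k ! * (x / k !)) P′≡P ⟩
    k ! * ((q Combinatorics.P k) / k !)  ≡⟨ cong (k ! *_) (sym (nCk≡nPk/k! k≤q)) ⟩
    k ! * (q C k)                        ∎
    where
    instance
      k!≢0 : NonZero (k !)
      k!≢0 = k !≢0
    P′≡P : q P′ k ≡ q Combinatorics.P k
    P′≡P = trans (nP′k≡n!/[n∸k]! k≤q) (sym (nPk≡n!/[n∸k]! k≤q))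

module Diagonals (m : ℕ) .{{_ : NonZero m}} where
  open import Data.Nat using (_+_; _*_; _/_)
  open import Data.Nat.Properties
  open import Data.Nat.DivMod using (+-distrib-/-∣ʳ; m*n/n≡m)
  open import Data.Nat.Divisibility using (divides-refl)
  open import Data.Sum using (_⊎_)
  open import Data.Product using (∃)

  OnDiagonal : ℕ → ℕ → ℕ → Set
  OnDiagonal a b N = a ≡ b + m * N

  block-shift : ∀ a N → (a + m * N) / m ≡ a / m + N
  block-shift a N = begin
    (a + m * N) / m   ≡⟨ cong (λ x → (a + x) / m) (*-comm m N) ⟩
    (a + N * m) / m   ≡⟨ +-distrib-/-∣ʳ a (divides-refl N) ⟩
    a / m + N * m / m ≡⟨ cong (a / m +_) (m*n/n≡m N m) ⟩
    a / m + N         ∎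
    where open ≡-Reasoning

  diagonal-unique : ∀ {a b N N′} → OnDiagonal a b N → OnDiagonal a b N′ → N ≡ N′
  diagonal-unique {a} {b} {N} {N′} e e′ = *-cancelˡ-≡ N N′ m (+-cancelˡ-≡ b _ _ (trans (sym e) e′))

  diagonal? : ∀ a b → (∃ λ N → OnDiagonal a b N) ⊎ (∀ N → ¬ OnDiagonal a b N)
  diagonal? a b with a ≟ b + m * ((a ∸ b) / m)
  ... | yes e = inj₁ (_ , e)
  ... | no ne = inj₂ λ N e → ne (trans e (cong (λ x → b + m * x) (sym (quotient N e))))
    where
    quotient : ∀ N → OnDiagonal a b N → (a ∸ b) / m ≡ N
    quotient N e = trans (cong (λ x → (x ∸ b) / m) e)
                         (trans (cong (_/ m) (trans (m+n∸m≡n b (m * N)) (*-comm m N))) (m*n/n≡m N m))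

  diagonal-+ : ∀ c s t → c + m * (s + t) ≡ (c + m * s) + m * t
  diagonal-+ c s t = trans (cong (c +_) (*-distribˡ-+ m s t)) (sym (+-assoc c (m * s) (m * t)))

  diagonal-0 : ∀ {a b} → a ≡ b → OnDiagonal a b 0
  diagonal-0 {a} {b} a≡b = trans a≡b (sym (trans (cong (b +_) (*-zeroʳ m)) (+-identityʳ b)))

  diagonal-0⁻¹ : ∀ {a b} → OnDiagonal a b 0 → a ≡ b
  diagonal-0⁻¹ {a} {b} e = trans e (trans (cong (b +_) (*-zeroʳ m)) (+-identityʳ b))

  diagonal-trans : ∀ {a b c s t} → OnDiagonal a b t → OnDiagonal b c s → OnDiagonal a c (s + t)
  diagonal-trans {a} {b} {c} {s} {t} e e′ =
    trans e (trans (cong (_+ m * t) e′) (sym (diagonal-+ c s t)))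

  diagonal-cancel : ∀ {a b c s t} → OnDiagonal a c (s + t) → OnDiagonal b c s → OnDiagonal a b t
  diagonal-cancel {a} {b} {c} {s} {t} e e′ =
    trans e (trans (diagonal-+ c s t) (cong (_+ m * t) (sym e′)))

  diagonal-block : ∀ {a b t} → OnDiagonal a b t → a / m ∸ t ≡ b / m
  diagonal-block {a} {b} {t} e = trans (cong (λ x → x / m ∸ t) e) (trans (cong (_∸ t) (block-shift b t)) (m+n∸n≡m (b / m) t))

  diagonal-index-≤ : ∀ {a b N} → OnDiagonal a b N → N ≤ a
  diagonal-index-≤ {a} {b} {N} e = ≤-trans (m≤n*m N m) (≤-trans (m≤n+m (m * N) b) (≤-reflexive (sym e)))

open FallingFactorial

open Rational using (_+_; _*_)

toℚᵘ-ℕ→ℚ : ∀ a → toℚᵘ (ℕ→ℚ a) ℚᵘ.≃ ℚᵘ.mkℚᵘ (ℤ.+ a) 0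
toℚᵘ-ℕ→ℚ a = ℚP.toℚᵘ-fromℚᵘ (ℚᵘ.mkℚᵘ (ℤ.+ a) 0)

ℕ→ℚ-* : ∀ a b → ℕ→ℚ (a ℕ.* b) ≡ ℕ→ℚ a * ℕ→ℚ b
ℕ→ℚ-* a b = ℚP.toℚᵘ-injective (begin
  toℚᵘ (ℕ→ℚ (a ℕ.* b))                         ≈⟨ toℚᵘ-ℕ→ℚ (a ℕ.* b) ⟩
  ℚᵘ.mkℚᵘ (ℤ.+ (a ℕ.* b)) 0                     ≈⟨ ℚᵘ.*≡* (cong (ℤ._* ℤ.+ 1) (ℤP.pos-* a b)) ⟩
  ℚᵘ.mkℚᵘ (ℤ.+ a) 0 ℚᵘ.* ℚᵘ.mkℚᵘ (ℤ.+ b) 0     ≈⟨ ℚᵘP.*-cong (toℚᵘ-ℕ→ℚ a) (toℚᵘ-ℕ→ℚ b) ⟨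
  toℚᵘ (ℕ→ℚ a) ℚᵘ.* toℚᵘ (ℕ→ℚ b)               ≈⟨ ℚP.toℚᵘ-homo-* (ℕ→ℚ a) (ℕ→ℚ b) ⟨
  toℚᵘ (ℕ→ℚ a * ℕ→ℚ b)                         ∎)
  where open ℚᵘP.≃-Reasoning

/-inverseˡ : ∀ d .{{_ : NonZero d}} → ((ℤ.+ 1) Rational./ d) * ℕ→ℚ d ≡ 1ℚ
/-inverseˡ (suc d) = ℚP.toℚᵘ-injective (begin
  toℚᵘ (1/d * ℕ→ℚ (suc d))         ≈⟨ ℚP.toℚᵘ-homo-* 1/d (ℕ→ℚ (suc d)) ⟩
  toℚᵘ 1/d ℚᵘ.* toℚᵘ (ℕ→ℚ (suc d))  ≈⟨ ℚᵘP.*-cong (ℚP.toℚᵘ-fromℚᵘ (ℚᵘ.mkℚᵘ (ℤ.+ 1) d)) (toℚᵘ-ℕ→ℚ (suc d)) ⟩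
  ℚᵘ.1/ d′ ℚᵘ.* d′                  ≈⟨ ℚᵘP.*-inverseˡ d′ ⟩
  ℚᵘ.1ℚᵘ                            ∎)
  where
  open ℚᵘP.≃-Reasoning
  1/d = (ℤ.+ 1) Rational./ suc d
  d′ = ℚᵘ.mkℚᵘ (ℤ.+ suc d) 0

inv!-cancel : ∀ k x → inv! k * ℕ→ℚ (k ! ℕ.* x) ≡ ℕ→ℚ x
inv!-cancel k x = begin
  inv! k * ℕ→ℚ (k ! ℕ.* x)       ≡⟨ cong (inv! k *_) (ℕ→ℚ-* (k !) x) ⟩
  inv! k * (ℕ→ℚ (k !) * ℕ→ℚ x)   ≡⟨ sym (ℚP.*-assoc (inv! k) _ _) ⟩
  (inv! k * ℕ→ℚ (k !)) * ℕ→ℚ x   ≡⟨ cong (_* ℕ→ℚ x) (/-inverseˡ (k !) {{k !≢0}}) ⟩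
  1ℚ * ℕ→ℚ x                      ≡⟨ ℚP.*-identityˡ _ ⟩
  ℕ→ℚ x                           ∎
  where open ≡-Reasoning

falling-binomial : ∀ q k → inv! k * ℕ→ℚ (q P′ k) ≡ ℕ→ℚ (q C k)
falling-binomial q k = trans (cong (λ x → inv! k * ℕ→ℚ x) (falling≡!*C q k)) (inv!-cancel k (q C k))

-- q^(s+t) falling / s! = q^(t) falling · C(q - t, s): the identity behind
-- multiplying by the factor I + c_s H_{n,s}.
falling-split : ∀ q s t → inv! s * ℕ→ℚ (q P′ (s ℕ.+ t)) ≡ ℕ→ℚ (q P′ t) * ℕ→ℚ ((q ∸ t) C s)
falling-split q s t = begin
  inv! s * ℕ→ℚ (q P′ (s ℕ.+ t))                     ≡⟨ cong (λ x → inv! s * ℕ→ℚ (q P′ x)) (ℕP.+-comm s t) ⟩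
  inv! s * ℕ→ℚ (q P′ (t ℕ.+ s))                     ≡⟨ cong (λ x → inv! s * ℕ→ℚ x) (falling-+ q t s) ⟩
  inv! s * ℕ→ℚ ((q P′ t) ℕ.* ((q ∸ t) P′ s))        ≡⟨ cong (inv! s *_) (ℕ→ℚ-* (q P′ t) _) ⟩
  inv! s * (ℕ→ℚ (q P′ t) * ℕ→ℚ ((q ∸ t) P′ s))      ≡⟨ x∙yz≈y∙xz (inv! s) (ℕ→ℚ (q P′ t)) (ℕ→ℚ ((q ∸ t) P′ s)) ⟩
  ℕ→ℚ (q P′ t) * (inv! s * ℕ→ℚ ((q ∸ t) P′ s))      ≡⟨ cong (ℕ→ℚ (q P′ t) *_) (falling-binomial (q ∸ t) s) ⟩
  ℕ→ℚ (q P′ t) * ℕ→ℚ ((q ∸ t) C s)                  ∎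
  where
  open ≡-Reasoning
  open CommSemigroupProperties (CommutativeMonoid.commutativeSemigroup ℚP.*-1-commutativeMonoid) using (x∙yz≈y∙xz)

+-interchange : ∀ a b c d → (a + b) + (c + d) ≡ (a + c) + (b + d)
+-interchange = interchange
  where open CommSemigroupProperties (CommutativeMonoid.commutativeSemigroup ℚP.+-0-commutativeMonoid) using (interchange)

sumℚ-cong : ∀ K {f g : ℕ → ℚ} → (∀ k → f k ≡ g k) → sumℚ K f ≡ sumℚ K g
sumℚ-cong zero    f≗g = refl
sumℚ-cong (suc K) f≗g = cong₂ _+_ (sumℚ-cong K f≗g) (f≗g K)

sumℚ-zero : ∀ K {f : ℕ → ℚ} → (∀ k → k < K → f k ≡ 0ℚ) → sumℚ K f ≡ 0ℚ
sumℚ-zero zero    f≡0 = refl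
sumℚ-zero (suc K) f≡0 =
  trans (cong₂ _+_ (sumℚ-zero K (λ k k<K → f≡0 k (ℕP.m<n⇒m<1+n k<K))) (f≡0 K ℕP.≤-refl)) (ℚP.+-identityʳ 0ℚ)

sumℚ-one : ∀ K {f : ℕ → ℚ} p → p < K → (∀ k → k < K → k ≢ p → f k ≡ 0ℚ) → sumℚ K f ≡ f p
sumℚ-one (suc K) {f} p p<1+K others≡0 with p ≟ K
... | yes refl = trans (cong (_+ f p) (sumℚ-zero K (λ k k<p → others≡0 k (ℕP.m<n⇒m<1+n k<p) (ℕP.<⇒≢ k<p))))
                       (ℚP.+-identityˡ (f p))
... | no p≢K = trans (cong₂ _+_ (sumℚ-one K p p<K (λ k k<K → others≡0 k (ℕP.m<n⇒m<1+n k<K)))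
                                 (others≡0 K ℕP.≤-refl (p≢K ∘ sym)))
                     (ℚP.+-identityʳ (f p))
  where
  p<K : p < K
  p<K = ℕP.≤∧≢⇒< (ℕ.s≤s⁻¹ p<1+K) p≢K

sumℚ-+ : ∀ K (f g : ℕ → ℚ) → sumℚ K (λ k → f k + g k) ≡ sumℚ K f + sumℚ K g
sumℚ-+ zero    f g = sym (ℚP.+-identityʳ 0ℚ)
sumℚ-+ (suc K) f g = trans (cong (_+ (f K + g K)) (sumℚ-+ K f g)) (+-interchange (sumℚ K f) (sumℚ K g) (f K) (g K))

sumFin-cong : ∀ n {f g : Fin n → ℚ} → (∀ l → f l ≡ g l) → sumFin n f ≡ sumFin n g
sumFin-cong zero    f≗g = refl
sumFin-cong (suc n) f≗g = cong₂ _+_ (f≗g Fin.zero) (sumFin-cong n (f≗g ∘ Fin.suc))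

sumFin-zero : ∀ n {f : Fin n → ℚ} → (∀ l → f l ≡ 0ℚ) → sumFin n f ≡ 0ℚ
sumFin-zero zero    f≡0 = refl
sumFin-zero (suc n) f≡0 = trans (cong₂ _+_ (f≡0 Fin.zero) (sumFin-zero n (λ l → f≡0 (Fin.suc l)))) (ℚP.+-identityʳ 0ℚ)

sumFin-one : ∀ n {f : Fin n → ℚ} p → (∀ l → l ≢ p → f l ≡ 0ℚ) → sumFin n f ≡ f p
sumFin-one (suc n) {f} Fin.zero others≡0 =
  trans (cong (λ x → f Fin.zero + x) (sumFin-zero n (λ l → others≡0 (Fin.suc l) (λ ()))))
        (ℚP.+-identityʳ (f Fin.zero))
sumFin-one (suc n) {f} (Fin.suc p) others≡0 =
  trans (cong₂ _+_ (others≡0 Fin.zero (λ ()))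
                   (sumFin-one n p (λ l l≢p → others≡0 (Fin.suc l) (l≢p ∘ FinP.suc-injective))))
        (ℚP.+-identityˡ (f (Fin.suc p)))

sumFin-+ : ∀ n (f g : Fin n → ℚ) → sumFin n (λ l → f l + g l) ≡ sumFin n f + sumFin n g
sumFin-+ zero    f g = sym (ℚP.+-identityʳ 0ℚ)
sumFin-+ (suc n) f g =
  trans (cong (λ x → (f Fin.zero + g Fin.zero) + x) (sumFin-+ n (λ l → f (Fin.suc l)) (λ l → g (Fin.suc l))))
        (+-interchange (f Fin.zero) (g Fin.zero) _ _)

single : ℕ → ℚ → ℕ → ℚ
single zero    x zero    = x
single zero    x (suc N) = 0ℚ
single (suc k) x zero    = 0ℚ
single (suc k) x (suc N) = single k x N

single-at : ∀ k x → single k x k ≡ x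
single-at zero    x = refl
single-at (suc k) x = single-at k x

single-off : ∀ {k N} x → N ≢ k → single k x N ≡ 0ℚ
single-off {zero}  {zero}  x N≢k = ⊥-elim (N≢k refl)
single-off {zero}  {suc N} x N≢k = refl
single-off {suc k} {zero}  x N≢k = refl
single-off {suc k} {suc N} x N≢k = single-off x (N≢k ∘ cong suc)

*-single : ∀ k y x N → y * single k x N ≡ single k (y * x) N
*-single zero    y x zero    = refl
*-single zero    y x (suc N) = ℚP.*-zeroʳ y
*-single (suc k) y x zero    = ℚP.*-zeroʳ y
*-single (suc k) y x (suc N) = *-single k y x N

sum-single : ∀ {N K} (x : ℕ → ℚ) → N < K → sumℚ K (λ k → single k (x k) N) ≡ x N
sum-single {N} {K} x N<K =
  trans (sumℚ-one K N N<K (λ k _ k≢N → single-off (x k) (k≢N ∘ sym))) (single-at N (x N))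

single-*-at : ∀ k x (y : ℕ → ℚ) N → single k x N * y N ≡ single k (x * y k) N
single-*-at zero    x y zero    = refl
single-*-at zero    x y (suc N) = ℚP.*-zeroˡ (y (suc N))
single-*-at (suc k) x y zero    = ℚP.*-zeroˡ (y zero)
single-*-at (suc k) x y (suc N) = single-*-at k x (y ∘ suc) N

-- shifted s g is the series Xˢ·g: its N-th coefficient is g (N - s), or 0 if N < s.
shifted : ℕ → (ℕ → ℚ) → ℕ → ℚ
shifted zero    g N       = g N
shifted (suc s) g zero    = 0ℚ
shifted (suc s) g (suc N) = shifted s g N

shifted-at : ∀ s g t → shifted s g (s ℕ.+ t) ≡ g t
shifted-at zero    g t = refl
shifted-at (suc s) g t = shifted-at s g t

shifted-below : ∀ {s N} g → N < s → shifted s g N ≡ 0ℚ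
shifted-below {suc s} {zero}  g N<s = refl
shifted-below {suc s} {suc N} g N<s = shifted-below g (ℕ.s≤s⁻¹ N<s)

data Split (s : ℕ) : ℕ → Set where
  below : ∀ {N} → N < s → Split s N
  above : ∀ t → Split s (s ℕ.+ t)

split : ∀ s N → Split s N
split zero    N       = above N
split (suc s) zero    = below (s≤s z≤n)
split (suc s) (suc N) with split s N
... | below N<s = below (s≤s N<s)
... | above t   = above t

⋆-cong : ∀ f {g h : Series} → (∀ x → g x ≡ h x) → ∀ N → (f ⋆ g) N ≡ (f ⋆ h) N
⋆-cong f g≗h N = sumℚ-cong (suc N) (λ i → cong (f i *_) (g≗h (N ∸ i)))

⋆-+ : ∀ f g h N → (f ⋆ (λ x → g x + h x)) N ≡ (f ⋆ g) N + (f ⋆ h) N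
⋆-+ f g h N = trans (sumℚ-cong (suc N) (λ i → ℚP.*-distribˡ-+ (f i) (g (N ∸ i)) (h (N ∸ i))))
                    (sumℚ-+ (suc N) (λ i → f i * g (N ∸ i)) (λ i → f i * h (N ∸ i)))

⋆-single : ∀ f s a N → (f ⋆ single s a) N ≡ shifted s f N * a
⋆-single f s a N with split s N
... | below N<s = begin
  sumℚ (suc N) (λ i → f i * single s a (N ∸ i))  ≡⟨ sumℚ-zero (suc N) (λ i _ → term≡0 i) ⟩
  0ℚ                                              ≡⟨ sym (ℚP.*-zeroˡ a) ⟩
  0ℚ * a                                          ≡⟨ cong (_* a) (sym (shifted-below f N<s)) ⟩
  shifted s f N * a                               ∎
  where
  open ≡-Reasoning
  term≡0 : ∀ i → f i * single s a (N ∸ i) ≡ 0ℚ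
  term≡0 i = trans (cong (f i *_) (single-off a (ℕP.<⇒≢ (ℕP.≤-<-trans (ℕP.m∸n≤m N i) N<s))))
                   (ℚP.*-zeroʳ (f i))
... | above t = begin
  sumℚ (suc (s ℕ.+ t)) (λ i → f i * single s a (s ℕ.+ t ∸ i))
      ≡⟨ sumℚ-one (suc (s ℕ.+ t)) t (s≤s (ℕP.m≤n+m t s)) term≡0 ⟩
  f t * single s a (s ℕ.+ t ∸ t)   ≡⟨ cong (λ x → f t * single s a x) (ℕP.m+n∸n≡m s t) ⟩
  f t * single s a s               ≡⟨ cong (f t *_) (single-at s a) ⟩
  f t * a                          ≡⟨ cong (_* a) (sym (shifted-at s f t)) ⟩
  shifted s f (s ℕ.+ t) * a        ∎
  where
  open ≡-Reasoning
  -- only i = t contributes, since (s + t) - i = s forces i = t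
  term≡0 : ∀ i → i < suc (s ℕ.+ t) → i ≢ t → f i * single s a (s ℕ.+ t ∸ i) ≡ 0ℚ
  term≡0 i i<1+s+t i≢t = trans (cong (f i *_) (single-off a (i≢t ∘ index))) (ℚP.*-zeroʳ (f i))
    where
    index : s ℕ.+ t ∸ i ≡ s → i ≡ t
    index e = begin
      i                          ≡⟨ sym (ℕP.m∸[m∸n]≡n (ℕ.s≤s⁻¹ i<1+s+t)) ⟩
      s ℕ.+ t ∸ (s ℕ.+ t ∸ i)    ≡⟨ cong (s ℕ.+ t ∸_) e ⟩
      s ℕ.+ t ∸ s                ≡⟨ ℕP.m+n∸m≡n s t ⟩
      t                          ∎

onePlusMono-split : ∀ a s x → onePlusMono a (suc s) x ≡ single 0 1ℚ x + single (suc s) a x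
onePlusMono-split a s x with x ≟ suc s
... | yes refl = sym (trans (cong (0ℚ +_) (single-at s a)) (ℚP.+-identityˡ a))
onePlusMono-split a s zero    | no _ = sym (ℚP.+-identityʳ 1ℚ)
onePlusMono-split a s (suc x) | no x≢s =
  sym (trans (cong (0ℚ +_) (single-off a (x≢s ∘ cong suc))) (ℚP.+-identityʳ 0ℚ))

prodS-step : ∀ c K N → prodS c (suc K) N ≡ prodS c K N + shifted (suc K) (prodS c K) N * (c (suc K) * inv! (suc K))
prodS-step c K N = begin
  (f ⋆ onePlusMono a (suc K)) N                          ≡⟨ ⋆-cong f (onePlusMono-split a K) N ⟩
  (f ⋆ (λ x → single 0 1ℚ x + single (suc K) a x)) N     ≡⟨ ⋆-+ f (single 0 1ℚ) (single (suc K) a) N ⟩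
  (f ⋆ single 0 1ℚ) N + (f ⋆ single (suc K) a) N         ≡⟨ cong₂ _+_ (⋆-single f 0 1ℚ N) (⋆-single f (suc K) a N) ⟩
  f N * 1ℚ + shifted (suc K) f N * a                     ≡⟨ cong (_+ shifted (suc K) f N * a) (ℚP.*-identityʳ (f N)) ⟩
  f N + shifted (suc K) f N * a                          ∎
  where
  open ≡-Reasoning
  f : Series
  f = prodS c K
  a : ℚ
  a = c (suc K) * inv! (suc K)

prodS-step-below : ∀ c K {N} → N < suc K → prodS c (suc K) N ≡ prodS c K N
prodS-step-below c K {N} N<1+K = begin
  prodS c (suc K) N                                 ≡⟨ prodS-step c K N ⟩
  prodS c K N + shifted (suc K) (prodS c K) N * a   ≡⟨ cong (λ x → prodS c K N + x * a) (shifted-below (prodS c K) N<1+K) ⟩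
  prodS c K N + 0ℚ * a                              ≡⟨ cong (prodS c K N +_) (ℚP.*-zeroˡ a) ⟩
  prodS c K N + 0ℚ                                  ≡⟨ ℚP.+-identityʳ (prodS c K N) ⟩
  prodS c K N                                       ∎
  where
  open ≡-Reasoning
  a : ℚ
  a = c (suc K) * inv! (suc K)

prodS-stable : ∀ c d N → prodS c (d ℕ.+ N) N ≡ prodS c N N
prodS-stable c zero    N = refl
prodS-stable c (suc d) N = trans (prodS-step-below c (d ℕ.+ N) (s≤s (ℕP.m≤n+m N d))) (prodS-stable c d N)

exp-coefficient : ∀ c → IsExpProdCoeffs c → ∀ {K N} → N ≤ K → prodS c K N ≡ inv! N
exp-coefficient c isExp {K} {N} N≤K = begin
  prodS c K N                  ≡⟨ cong (λ x → prodS c x N) (sym (ℕP.m∸n+n≡m N≤K)) ⟩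
  prodS c (K ∸ N ℕ.+ N) N      ≡⟨ prodS-stable c (K ∸ N) N ⟩
  prodS c N N                  ≡⟨ isExp N ⟩
  inv! N                       ∎
  where open ≡-Reasoning

-- The coefficient identity behind multiplying by the factor I + c_s H_{n,s},
-- s = K + 1.  With φ N q = [X^N] ∏_{k≤K} (1 + c_k/k! Xᵏ) · q^(N), the old symbol
-- plus its s-fold shift weighted by c_s·C(q - t, s) is the new symbol; at
-- N = s + t this is q^(s+t)/s! = q^(t)·C(q - t, s).
prodS-falling-step : ∀ c K q N →
  prodS c K N * ℕ→ℚ (q P′ N) * 1ℚ
    + shifted (suc K) (λ t → prodS c K t * ℕ→ℚ (q P′ t) * (c (suc K) * ℕ→ℚ ((q ∸ t) C suc K))) N
  ≡ prodS c (suc K) N * ℕ→ℚ (q P′ N)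
prodS-falling-step c K q N with split (suc K) N
... | below N<s = begin
  φ N * 1ℚ + shifted s g N       ≡⟨ cong₂ _+_ (ℚP.*-identityʳ (φ N)) (shifted-below g N<s) ⟩
  φ N + 0ℚ                       ≡⟨ ℚP.+-identityʳ (φ N) ⟩
  prodS c K N * ℕ→ℚ (q P′ N)     ≡⟨ cong (_* ℕ→ℚ (q P′ N)) (sym (prodS-step-below c K N<s)) ⟩
  prodS c s N * ℕ→ℚ (q P′ N)     ∎
  where
  open ≡-Reasoning
  s : ℕ
  s = suc K
  φ : ℕ → ℚ
  φ N = prodS c K N * ℕ→ℚ (q P′ N)
  g : ℕ → ℚ
  g t = φ t * (c s * ℕ→ℚ ((q ∸ t) C s))
... | above t = begin
  x * X * 1ℚ + shifted s g (s ℕ.+ t)              ≡⟨ cong₂ _+_ (ℚP.*-identityʳ (x * X)) (shifted-at s g t) ⟩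
  x * X + y * F * (c s * B)                        ≡⟨ regroup x X y F (c s) B ⟩
  x * X + (y * c s) * (F * B)                      ≡⟨ cong (λ z → x * X + (y * c s) * z) (sym (falling-split q s t)) ⟩
  x * X + (y * c s) * (inv! s * X)                 ≡⟨ distribute x y (c s) (inv! s) X ⟩
  (x + y * (c s * inv! s)) * X                     ≡⟨ cong (λ z → (x + z * a) * X) (sym (shifted-at s (prodS c K) t)) ⟩
  (x + shifted s (prodS c K) (s ℕ.+ t) * a) * X    ≡⟨ cong (_* X) (sym (prodS-step c K (s ℕ.+ t))) ⟩
  prodS c s (s ℕ.+ t) * X                          ∎
  where
  open ≡-Reasoning
  open +-*-Solver
  s : ℕ
  s = suc K
  g : ℕ → ℚ
  g t = prodS c K t * ℕ→ℚ (q P′ t) * (c s * ℕ→ℚ ((q ∸ t) C s))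
  a x y X F B : ℚ
  a = c s * inv! s
  x = prodS c K (s ℕ.+ t)
  y = prodS c K t
  X = ℕ→ℚ (q P′ (s ℕ.+ t))
  F = ℕ→ℚ (q P′ t)
  B = ℕ→ℚ ((q ∸ t) C s)
  regroup : ∀ x X y F c B → x * X + y * F * (c * B) ≡ x * X + (y * c) * (F * B)
  regroup = solve 6 (λ x X y F c B → x :* X :+ y :* F :* (c :* B) := x :* X :+ (y :* c) :* (F :* B)) refl
  distribute : ∀ x y c u X → x * X + (y * c) * (u * X) ≡ (x + y * (c * u)) * X
  distribute = solve 5 (λ x y c u X → x :* X :+ (y :* c) :* (u :* X) := (x :+ y :* (c :* u)) :* X) refl

⊗-distribˡ-⊕ : ∀ {n} (A B C : Mat n) → (A ⊗ (B ⊕ C)) ≡M ((A ⊗ B) ⊕ (A ⊗ C))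
⊗-distribˡ-⊕ {n} A B C i j =
  trans (sumFin-cong n (λ l → ℚP.*-distribˡ-+ (A i l) (B l j) (C l j)))
        (sumFin-+ n (λ l → A i l * B l j) (λ l → A i l * C l j))

module Symbols (m : ℕ) .{{_ : NonZero m}} (n : ℕ) where
  open Diagonals m

  block : Fin n → ℕ
  block i = toℕ i ℕ./ m

  record HasSymbol (A : Mat n) (φ : ℕ → ℕ → ℚ) : Set where
    constructor symbol
    field
      on-diagonal  : ∀ i j N → OnDiagonal (toℕ i) (toℕ j) N → A i j ≡ φ N (block i)
      off-diagonal : ∀ i j → (∀ N → ¬ OnDiagonal (toℕ i) (toℕ j) N) → A i j ≡ 0ℚ
  open HasSymbol

  symbol-unique : ∀ {A B φ ψ} → HasSymbol A φ → HasSymbol B ψ →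
                  (∀ N q → N < n → φ N q ≡ ψ N q) → A ≡M B
  symbol-unique {A} {B} {φ} {ψ} hA hB φ≡ψ i j with diagonal? (toℕ i) (toℕ j)
  ... | inj₁ (N , e) = begin
    A i j          ≡⟨ on-diagonal hA i j N e ⟩
    φ N (block i)  ≡⟨ φ≡ψ N (block i) (ℕP.≤-<-trans (diagonal-index-≤ e) (FinP.toℕ<n i)) ⟩
    ψ N (block i)  ≡⟨ sym (on-diagonal hB i j N e) ⟩
    B i j          ∎
    where open ≡-Reasoning
  ... | inj₂ none = trans (off-diagonal hA i j none) (sym (off-diagonal hB i j none))

  symbol-cong : ∀ {A φ ψ} → (∀ N q → φ N q ≡ ψ N q) → HasSymbol A φ → HasSymbol A ψ
  symbol-cong φ≡ψ hA = symbol (λ i j N e → trans (on-diagonal hA i j N e) (φ≡ψ N _)) (off-diagonal hA)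

  symbol-resp : ∀ {A B φ} → A ≡M B → HasSymbol A φ → HasSymbol B φ
  symbol-resp A≡B hA = symbol (λ i j N e → trans (sym (A≡B i j)) (on-diagonal hA i j N e))
                              (λ i j none → trans (sym (A≡B i j)) (off-diagonal hA i j none))

  symbol-𝟘 : HasSymbol 𝟘 (λ _ _ → 0ℚ)
  symbol-𝟘 = symbol (λ _ _ _ _ → refl) (λ _ _ _ → refl)

  symbol-⊕ : ∀ {A B φ ψ} → HasSymbol A φ → HasSymbol B ψ → HasSymbol (A ⊕ B) (λ N q → φ N q + ψ N q)
  symbol-⊕ hA hB = symbol (λ i j N e → cong₂ _+_ (on-diagonal hA i j N e) (on-diagonal hB i j N e))
                          (λ i j none → trans (cong₂ _+_ (off-diagonal hA i j none) (off-diagonal hB i j none))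
                                              (ℚP.+-identityʳ 0ℚ))

  symbol-· : ∀ {A φ} a → HasSymbol A φ → HasSymbol (a · A) (λ N q → a * φ N q)
  symbol-· a hA = symbol (λ i j N e → cong (a *_) (on-diagonal hA i j N e))
                         (λ i j none → trans (cong (a *_) (off-diagonal hA i j none)) (ℚP.*-zeroʳ a))

  symbol-sumM : ∀ K {G : ℕ → Mat n} {φ : ℕ → ℕ → ℕ → ℚ} → (∀ k → HasSymbol (G k) (φ k)) →
                HasSymbol (sumM K G) (λ N q → sumℚ K (λ k → φ k N q))
  symbol-sumM zero    hG = symbol-𝟘
  symbol-sumM (suc K) hG = symbol-⊕ (symbol-sumM K hG) (hG K)

  symbol-I : HasSymbol (I n) (λ N _ → single 0 1ℚ N)
  symbol-I = symbol on off
    where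
    on : ∀ i j N → OnDiagonal (toℕ i) (toℕ j) N → I n i j ≡ single 0 1ℚ N
    on i j N e with toℕ i ≟ toℕ j
    on i j zero    e | yes _   = refl
    on i j (suc N) e | yes i≡j = ⊥-elim (ℕP.0≢1+n (diagonal-unique (diagonal-0 i≡j) e))
    on i j zero    e | no i≢j  = ⊥-elim (i≢j (diagonal-0⁻¹ e))
    on i j (suc N) e | no _    = refl
    off : ∀ i j → (∀ N → ¬ OnDiagonal (toℕ i) (toℕ j) N) → I n i j ≡ 0ℚ
    off i j none with toℕ i ≟ toℕ j
    ... | yes i≡j = ⊥-elim (none 0 (diagonal-0 i≡j))
    ... | no _    = refl

  symbol-Hk : ∀ k → HasSymbol (Hk m n k) (λ N q → single k (ℕ→ℚ (q C k)) N)
  symbol-Hk k = symbol on off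
    where
    on : ∀ i j N → OnDiagonal (toℕ i) (toℕ j) N → Hk m n k i j ≡ single k (ℕ→ℚ (block i C k)) N
    on i j N e with toℕ i ≟ toℕ j ℕ.+ m ℕ.* k
    ... | yes e′ with diagonal-unique e e′
    ...   | refl = sym (single-at k _)
    on i j N e | no ¬e′ = sym (single-off _ (λ N≡k → ¬e′ (subst (OnDiagonal (toℕ i) (toℕ j)) N≡k e)))
    off : ∀ i j → (∀ N → ¬ OnDiagonal (toℕ i) (toℕ j) N) → Hk m n k i j ≡ 0ℚ
    off i j none with toℕ i ≟ toℕ j ℕ.+ m ℕ.* k
    ... | yes e′ = ⊥-elim (none k e′)
    ... | no _   = refl

  -- Right multiplication by a matrix living on the s-th diagonal with entries
  -- β ⌊l/m⌋ moves the symbol s diagonals down: the column l = j + m s is the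
  -- only one contributing, and for i on the t-th diagonal below l we have
  -- ⌊l/m⌋ = ⌊i/m⌋ - t.
  symbol-⊗-single : ∀ {A B φ} s (β : ℕ → ℚ) → HasSymbol A φ → HasSymbol B (λ N q → single s (β q) N) →
                    HasSymbol (A ⊗ B) (λ N q → shifted s (λ t → φ t q * β (q ∸ t)) N)
  symbol-⊗-single {A} {B} {φ} s β hA hB = symbol on off
    where
    B-off : ∀ l j → ¬ OnDiagonal (toℕ l) (toℕ j) s → B l j ≡ 0ℚ
    B-off l j ¬e with diagonal? (toℕ l) (toℕ j)
    ... | inj₁ (N , e) = trans (on-diagonal hB l j N e) (single-off _ (λ N≡s → ¬e (subst (OnDiagonal (toℕ l) (toℕ j)) N≡s e)))
    ... | inj₂ none    = off-diagonal hB l j none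

    product≡0 : ∀ i j → (∀ l → OnDiagonal (toℕ l) (toℕ j) s → A i l ≡ 0ℚ) → (A ⊗ B) i j ≡ 0ℚ
    product≡0 i j A≡0 = sumFin-zero n term≡0
      where
      term≡0 : ∀ l → A i l * B l j ≡ 0ℚ
      term≡0 l with toℕ l ≟ toℕ j ℕ.+ m ℕ.* s
      ... | yes e = trans (cong (_* B l j) (A≡0 l e)) (ℚP.*-zeroˡ (B l j))
      ... | no ¬e = trans (cong (A i l *_) (B-off l j ¬e)) (ℚP.*-zeroʳ (A i l))

    product≡ : ∀ i j l₀ → OnDiagonal (toℕ l₀) (toℕ j) s → (A ⊗ B) i j ≡ A i l₀ * β (block l₀)
    product≡ i j l₀ e₀ = trans (sumFin-one n l₀ term≡0) (cong (A i l₀ *_) (trans (on-diagonal hB l₀ j s e₀) (single-at s _)))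
      where
      term≡0 : ∀ l → l ≢ l₀ → A i l * B l j ≡ 0ℚ
      term≡0 l l≢l₀ = trans (cong (A i l *_) (B-off l j (λ e → l≢l₀ (FinP.toℕ-injective (trans e (sym e₀))))))
                            (ℚP.*-zeroʳ (A i l))

    on : ∀ i j N → OnDiagonal (toℕ i) (toℕ j) N → (A ⊗ B) i j ≡ shifted s (λ t → φ t (block i) * β (block i ∸ t)) N
    on i j N e with split s N
    ... | below N<s = trans (product≡0 i j (λ l e′ → off-diagonal hA i l (λ t e″ → s+t≰N t (diagonal-trans e″ e′))))
                            (sym (shifted-below _ N<s))
      where
      s+t≰N : ∀ t → ¬ OnDiagonal (toℕ i) (toℕ j) (s ℕ.+ t)
      s+t≰N t e′ = ℕP.<⇒≱ N<s (ℕP.≤-trans (ℕP.m≤m+n s t) (ℕP.≤-reflexive (diagonal-unique e′ e)))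
    ... | above t = begin
      (A ⊗ B) i j                              ≡⟨ product≡ i j l₀ e₀ ⟩
      A i l₀ * β (block l₀)                    ≡⟨ cong₂ _*_ (on-diagonal hA i l₀ t i-below-l₀) (cong β (sym (diagonal-block i-below-l₀))) ⟩
      φ t (block i) * β (block i ∸ t)          ≡⟨ sym (shifted-at s _ t) ⟩
      shifted s (λ t → φ t (block i) * β (block i ∸ t)) (s ℕ.+ t) ∎
      where
      open ≡-Reasoning
      -- the column l₀ = j + m s fits into the matrix, being at most i
      l₀<n : toℕ j ℕ.+ m ℕ.* s < n
      l₀<n = ℕP.≤-<-trans (ℕP.≤-trans (ℕP.m≤m+n _ (m ℕ.* t)) (ℕP.≤-reflexive (trans (sym (diagonal-+ (toℕ j) s t)) (sym e))))
                          (FinP.toℕ<n i)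
      l₀ : Fin n
      l₀ = fromℕ< l₀<n
      e₀ : OnDiagonal (toℕ l₀) (toℕ j) s
      e₀ = FinP.toℕ-fromℕ< l₀<n
      i-below-l₀ : OnDiagonal (toℕ i) (toℕ l₀) t
      i-below-l₀ = diagonal-cancel e e₀

    off : ∀ i j → (∀ N → ¬ OnDiagonal (toℕ i) (toℕ j) N) → (A ⊗ B) i j ≡ 0ℚ
    off i j none = product≡0 i j (λ l e′ → off-diagonal hA i l (λ t e″ → none (s ℕ.+ t) (diagonal-trans e″ e′)))

  symbol-H^ : ∀ k → HasSymbol (H m n ^M k) (λ N q → single k (ℕ→ℚ (q P′ k)) N)
  symbol-H^ zero    = symbol-I
  symbol-H^ (suc k) = symbol-cong step (symbol-⊗-single 1 (λ r → ℕ→ℚ (r C 1)) (symbol-H^ k) (symbol-Hk 1))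
    where
    -- q^(k) · (q - k) = q^(k+1)
    step : ∀ N q → shifted 1 (λ t → single k (ℕ→ℚ (q P′ k)) t * ℕ→ℚ ((q ∸ t) C 1)) N
                   ≡ single (suc k) (ℕ→ℚ (q P′ suc k)) N
    step zero    q = refl
    step (suc N) q = trans (single-*-at k _ (λ t → ℕ→ℚ ((q ∸ t) C 1)) N)
                           (cong (λ x → single k x N) (trans (sym (ℕ→ℚ-* (q P′ k) _)) (cong ℕ→ℚ falling-step)))
      where
      falling-step : (q P′ k) ℕ.* ((q ∸ k) C 1) ≡ q P′ suc k
      falling-step = trans (cong ((q P′ k) ℕ.*_) (nC1≡n (q ∸ k))) (ℕP.*-comm (q P′ k) (q ∸ k))

  symbol-scaled-power : ∀ k → HasSymbol (inv! k · (H m n ^M k)) (λ N q → single k (ℕ→ℚ (q C k)) N)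
  symbol-scaled-power k = symbol-cong scaled (symbol-· (inv! k) (symbol-H^ k))
    where
    scaled : ∀ N q → inv! k * single k (ℕ→ℚ (q P′ k)) N ≡ single k (ℕ→ℚ (q C k)) N
    scaled N q = trans (*-single k (inv! k) _ N) (cong (λ x → single k x N) (falling-binomial q k))

  symbol-prod : ∀ c K → HasSymbol (prodM₁ K (λ k → I n ⊕ (c k · Hk m n k)))
                                  (λ N q → prodS c K N * ℕ→ℚ (q P′ N))
  symbol-prod c zero = symbol-cong base symbol-I
    where
    base : ∀ N q → single 0 1ℚ N ≡ oneS N * ℕ→ℚ (q P′ N)
    base zero    q = refl
    base (suc N) q = sym (ℚP.*-zeroˡ (ℕ→ℚ (q P′ suc N)))
  symbol-prod c (suc K) =
    symbol-cong (λ N q → prodS-falling-step c K q N)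
      (symbol-resp (λ i j → sym (⊗-distribˡ-⊕ A (I n) (c s · Hk m n s) i j))
        (symbol-⊕ (symbol-⊗-single 0 (λ _ → 1ℚ) (symbol-prod c K) symbol-I)
                  (symbol-⊗-single s (λ r → c s * ℕ→ℚ (r C s)) (symbol-prod c K) factor)))
    where
    s : ℕ
    s = suc K
    A : Mat n
    A = prodM₁ K (λ k → I n ⊕ (c k · Hk m n k))
    factor : HasSymbol (c s · Hk m n s) (λ N r → single s (c s * ℕ→ℚ (r C s)) N)
    factor = symbol-cong (λ N r → *-single s (c s) _ N) (symbol-· (c s) (symbol-Hk s))

  symbol-P : HasSymbol (P m n) (λ N q → sumℚ n (λ k → single k (ℕ→ℚ (q C k)) N))
  symbol-P = symbol-sumM n symbol-Hk

-- H_{n,k} and Hᵏ/k! have the same symbol, and P, exp H and the product all have the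
-- binomial symbol C(⌊i/m⌋, N) on the diagonals N < n.
mainTheorem6 : (m n : ℕ) .{{_ : NonZero m}} .{{_ : NonZero n}}
    → (c : ℕ → ℚ) → IsExpProdCoeffs c
    → (∀ k → Hk m n k ≡M (inv! k · (H m n ^M k)))
      × (∀ K → n ≤ K → P m n ≡M expM K (H m n))
      × (∀ K → n ≤ K → P m n ≡M prodM₁ K (λ k → I n ⊕ (c k · Hk m n k)))
mainTheorem6 m n c isExp = powers , exponential , product
  where
  open Symbols m n
  open ≡-Reasoning

  binomial : ∀ {K} N q → N < K → sumℚ K (λ k → single k (ℕ→ℚ (q C k)) N) ≡ ℕ→ℚ (q C N)
  binomial N q = sum-single (λ k → ℕ→ℚ (q C k))

  powers : ∀ k → Hk m n k ≡M (inv! k · (H m n ^M k))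
  powers k = symbol-unique (symbol-Hk k) (symbol-scaled-power k) (λ _ _ _ → refl)

  exponential : ∀ K → n ≤ K → P m n ≡M expM K (H m n)
  exponential K n≤K = symbol-unique symbol-P (symbol-sumM K symbol-scaled-power)
    (λ N q N<n → trans (binomial N q N<n) (sym (binomial N q (ℕP.<-≤-trans N<n n≤K))))

  product : ∀ K → n ≤ K → P m n ≡M prodM₁ K (λ k → I n ⊕ (c k · Hk m n k))
  product K n≤K = symbol-unique symbol-P (symbol-prod c K) λ N q N<n → begin
    sumℚ n (λ k → single k (ℕ→ℚ (q C k)) N)  ≡⟨ binomial N q N<n ⟩
    ℕ→ℚ (q C N)                               ≡⟨ sym (falling-binomial q N) ⟩
    inv! N * ℕ→ℚ (q P′ N)                     ≡⟨ cong (_* ℕ→ℚ (q P′ N)) (sym (exp-coefficient c isExp (ℕP.≤-trans (ℕP.<⇒≤ N<n) n≤K))) ⟩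
    prodS c K N * ℕ→ℚ (q P′ N)                ∎
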